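{- Let $P$ be a poset and suppose $P=\bigcup_{k\in\omega}P_k$ witnesses that $P$ is $\sigma$-$w$-finite-c.c. Then for any $k\in\omega$ and any sequence $\langle(a_i,b_i):i\in\omega\rangle\subseteq[P_k]^{<\omega}\times[P_k]^{<\omega}$ with $a_i\parallel b_i$ for all $i\in\omega$, there exist $l<j$ in $\omega$ such that $a_l\parallel b_j$.
   Context: $P=\bigcup_{k\in\omega}P_k$ witnesses $\sigma$-$w$-finite-c.c. if for each $k$ and each sequence $\langle(p_i,q_i):i\in\omega\rangle\subseteq P_k\times P_k$ with $p_i$ compatible with $q_i$ for all $i$, there exist $i<j$ such that $p_i$ is compatible with $q_j$. $[P_k]^{<\omega}$ is the set of finite subsets of $P_k$. For finite $a,b\subseteq P$, $a\parallel b$ means there exist $r\in a$ and $t\in b$ that are compatible in $P$. -}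

module Defs where

open import Level using (Level; _⊔_)
open import Data.Nat using (ℕ; _<_)
open import Data.Product using (Σ; ∃; _×_; _,_)
open import Data.List using (List)
open import Data.List.Membership.Propositional using (_∈_)
open import Data.List.Relation.Unary.All using (All)
open import Relation.Binary.Bundles using (Poset)

module _ {c ℓ₁ ℓ₂ : Level} (P : Poset c ℓ₁ ℓ₂) where
  open Poset P

  Compatible : Carrier → Carrier → Set (c ⊔ ℓ₂)
  Compatible p q = ∃ λ r → (r ≤ p) × (r ≤ q)

  FinCompat : List Carrier → List Carrier → Set (c ⊔ ℓ₂)
  FinCompat a b = ∃ λ r → ∃ λ t → (r ∈ a) × (t ∈ b) × Compatible r t

  Witnesses-σ-w-fcc : {ℓ : Level} → (ℕ → Carrier → Set ℓ) → Set (c ⊔ ℓ₂ ⊔ ℓ)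
  Witnesses-σ-w-fcc Pk =
    (∀ p → ∃ λ k → Pk k p) ×
    (∀ k (p q : ℕ → Carrier) →
       (∀ i → Pk k (p i)) → (∀ i → Pk k (q i)) →
       (∀ i → Compatible (p i) (q i)) →
       ∃ λ i → ∃ λ j → i < j × Compatible (p i) (q j))

{-# OPTIONS --safe #-}
module Submission where

open import Defs
open import Level using (Level)
open import Data.Nat using (ℕ; _<_)
open import Data.Product using (∃; _×_; _,_)
open import Data.List using (List)
open import Data.List.Membership.Propositional using (_∈_)
open import Data.List.Relation.Unary.All using (All; lookup)
open import Relation.Binary.Bundles using (Poset)

-- Choosing in each aᵢ ∥ bᵢ a compatible pair (rᵢ, tᵢ) turns the sequence of finite
-- sets into a sequence of pairs from P_k; a later compatibility rₗ ∥ tⱼ lifts back.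
module _ {c ℓ₁ ℓ₂ : Level} (P : Poset c ℓ₁ ℓ₂) (a b : ℕ → List (Poset.Carrier P))
         (a∥b : ∀ i → FinCompat P (a i) (b i)) where
  open Poset P using (Carrier)

  left-witness : ℕ → Carrier
  left-witness i with a∥b i
  ... | r , _ = r

  right-witness : ℕ → Carrier
  right-witness i with a∥b i
  ... | _ , t , _ = t

  left-witness-∈ : ∀ i → left-witness i ∈ a i
  left-witness-∈ i with a∥b i
  ... | _ , _ , r∈a , _ , _ = r∈a

  right-witness-∈ : ∀ i → right-witness i ∈ b i
  right-witness-∈ i with a∥b i
  ... | _ , _ , _ , t∈b , _ = t∈b

  witnesses-compatible : ∀ i → Compatible P (left-witness i) (right-witness i)
  witnesses-compatible i with a∥b i
  ... | _ , _ , _ , _ , r∼t = r∼t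

lemma5p9 : {c ℓ₁ ℓ₂ ℓ : Level} (P : Poset c ℓ₁ ℓ₂) (Pk : ℕ → Poset.Carrier P → Set ℓ) →
    Witnesses-σ-w-fcc P Pk →
    (k : ℕ) (a b : ℕ → List (Poset.Carrier P)) →
    (∀ i → All (Pk k) (a i)) → (∀ i → All (Pk k) (b i)) →
    (∀ i → FinCompat P (a i) (b i)) →
    ∃ λ l → ∃ λ j → l < j × FinCompat P (a l) (b j)
lemma5p9 P Pk (_ , chain-condition) k a b a⊆Pk b⊆Pk a∥b
  with chain-condition k (left-witness P a b a∥b) (right-witness P a b a∥b)
         (λ i → lookup (a⊆Pk i) (left-witness-∈ P a b a∥b i))
         (λ i → lookup (b⊆Pk i) (right-witness-∈ P a b a∥b i))
         (witnesses-compatible P a b a∥b)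
... | l , j , l<j , rₗ∼tⱼ =
  l , j , l<j , _ , _ , left-witness-∈ P a b a∥b l , right-witness-∈ P a b a∥b j , rₗ∼tⱼ
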